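{- Let $N$ be a pomonoid. Then $N$ is integrally closed if and only if $N$ is isomorphic to a nuclear image of some cancellative pomonoid. The same holds with "integrally closed" replaced by "integral" and "cancellative pomonoid" by "integral cancellative pomonoid"; with "integrally closed" replaced by "commutative integrally closed" and "cancellative" by "commutative cancellative"; and with "integrally closed" replaced by "commutative integral" and "cancellative" by "commutative integral cancellative".
   Context: A pomonoid is a monoid $\langle M,\cdot,1\rangle$ with a partial order $\leq$ such that multiplication is isotone in both arguments; it is integral if $1$ is the top element, cancellative if $ax\leq bx\Rightarrow a\leq b$ and $xa\leq xb\Rightarrow a\leq b$, and integrally closed if $ax\leq a\Rightarrow x\leq 1$ and $xa\leq a\Rightarrow x\leq 1$. A nucleus on $M$ is a monotone map $\gamma$ with $a\leq\gamma(a)=\gamma(\gamma(a))$ and $\gamma(a)\gamma(b)\leq\gamma(ab)$; the nuclear image $M_\gamma=\{a:\gamma(a)=a\}$ has the inherited order, multiplication $a\cdot_\gamma b=\gamma(ab)$ and unit $\gamma(1)$. -}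

module Defs where

open import Level using (Level; _⊔_; suc)
open import Data.Product using (Σ; ∃; _×_; _,_; proj₁; proj₂)
open import Relation.Binary.Core using (Rel; _Preserves_⟶_; _Preserves₂_⟶_⟶_)
open import Relation.Binary.Structures using (IsPartialOrder; IsPreorder; IsEquivalence)
open import Algebra.Structures using (IsMonoid; IsSemigroup; IsMagma)
import Relation.Binary.Reasoning.PartialOrder as POR

record Pomonoid (c ℓ₁ ℓ₂ : Level) : Set (suc (c ⊔ ℓ₁ ⊔ ℓ₂)) where
  infixl 7 _∙_
  infix 4 _≈_ _≤_
  field
    Carrier        : Set c
    _≈_            : Rel Carrier ℓ₁
    _≤_            : Rel Carrier ℓ₂
    _∙_            : Carrier → Carrier → Carrier
    ε              : Carrier
    isMonoid       : IsMonoid _≈_ _∙_ ε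
    isPartialOrder : IsPartialOrder _≈_ _≤_
    ∙-mono         : _∙_ Preserves₂ _≤_ ⟶ _≤_ ⟶ _≤_

  open IsMonoid isMonoid public
    using (assoc; identityˡ; identityʳ; ∙-cong; isEquivalence)
  open IsPartialOrder isPartialOrder public
    using (antisym; reflexive)
    renaming (refl to ≤-refl; trans to ≤-trans)

module _ {c ℓ₁ ℓ₂} (M : Pomonoid c ℓ₁ ℓ₂) where
  open Pomonoid M

  Integral : Set (c ⊔ ℓ₂)
  Integral = ∀ a → a ≤ ε

  Commutative : Set (c ⊔ ℓ₁)
  Commutative = ∀ a b → a ∙ b ≈ b ∙ a

  Cancellative : Set (c ⊔ ℓ₂)
  Cancellative = (∀ a b x → a ∙ x ≤ b ∙ x → a ≤ b)
               × (∀ a b x → x ∙ a ≤ x ∙ b → a ≤ b)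

  IntegrallyClosed : Set (c ⊔ ℓ₂)
  IntegrallyClosed = (∀ a x → a ∙ x ≤ a → x ≤ ε)
                   × (∀ a x → x ∙ a ≤ a → x ≤ ε)

  record Nucleus : Set (c ⊔ ℓ₁ ⊔ ℓ₂) where
    field
      γ            : Carrier → Carrier
      monotone     : ∀ {a b} → a ≤ b → γ a ≤ γ b
      extensive    : ∀ a → a ≤ γ a
      idempotent   : ∀ a → γ (γ a) ≈ γ a
      submultiplicative : ∀ a b → γ a ∙ γ b ≤ γ (a ∙ b)

module NuclearImageConstruction {c ℓ₁ ℓ₂} (M : Pomonoid c ℓ₁ ℓ₂)
                                (N : Nucleus M) where
  open Pomonoid M
  open Nucleus N
  module Eq = IsEquivalence isEquivalence

  ≈⇒≤ : ∀ {a b} → a ≈ b → a ≤ b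
  ≈⇒≤ = reflexive

  γ-cong : ∀ {a b} → a ≈ b → γ a ≈ γ b
  γ-cong p = antisym (monotone (≈⇒≤ p)) (monotone (≈⇒≤ (Eq.sym p)))

  Fix : Set (c ⊔ ℓ₁)
  Fix = Σ Carrier (λ a → γ a ≈ a)

  _≈ᶠ_ : Rel Fix ℓ₁
  x ≈ᶠ y = proj₁ x ≈ proj₁ y

  _≤ᶠ_ : Rel Fix ℓ₂
  x ≤ᶠ y = proj₁ x ≤ proj₁ y

  _∙ᶠ_ : Fix → Fix → Fix
  x ∙ᶠ y = γ (proj₁ x ∙ proj₁ y) , idempotent _

  εᶠ : Fix
  εᶠ = γ ε , idempotent _

  γ-absorbˡ : ∀ a b → γ (γ a ∙ b) ≈ γ (a ∙ b)
  γ-absorbˡ a b = antisym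
    (≤-trans (monotone (≤-trans (∙-mono ≤-refl (extensive b))
                                 (submultiplicative a b)))
             (≈⇒≤ (idempotent _)))
    (monotone (∙-mono (extensive a) ≤-refl))

  γ-absorbʳ : ∀ a b → γ (a ∙ γ b) ≈ γ (a ∙ b)
  γ-absorbʳ a b = antisym
    (≤-trans (monotone (≤-trans (∙-mono (extensive a) ≤-refl)
                                 (submultiplicative a b)))
             (≈⇒≤ (idempotent _)))
    (monotone (∙-mono ≤-refl (extensive b)))

  isEquivalenceᶠ : IsEquivalence _≈ᶠ_
  isEquivalenceᶠ = record { refl = Eq.refl ; sym = Eq.sym ; trans = Eq.trans }

  ∙ᶠ-cong : ∀ {x y u v} → x ≈ᶠ y → u ≈ᶠ v → (x ∙ᶠ u) ≈ᶠ (y ∙ᶠ v)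
  ∙ᶠ-cong p q = γ-cong (∙-cong p q)

  assocᶠ : ∀ x y z → ((x ∙ᶠ y) ∙ᶠ z) ≈ᶠ (x ∙ᶠ (y ∙ᶠ z))
  assocᶠ (a , _) (b , _) (d , _) =
    Eq.trans (γ-absorbˡ (a ∙ b) d)
      (Eq.trans (γ-cong (assoc a b d)) (Eq.sym (γ-absorbʳ a (b ∙ d))))

  identityˡᶠ : ∀ x → (εᶠ ∙ᶠ x) ≈ᶠ x
  identityˡᶠ (a , fa) = Eq.trans (γ-absorbˡ ε a)
                          (Eq.trans (γ-cong (identityˡ a)) fa)

  identityʳᶠ : ∀ x → (x ∙ᶠ εᶠ) ≈ᶠ x
  identityʳᶠ (a , fa) = Eq.trans (γ-absorbʳ a ε)
                          (Eq.trans (γ-cong (identityʳ a)) fa)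

  nuclearImage : Pomonoid (c ⊔ ℓ₁) ℓ₁ ℓ₂
  nuclearImage = record
    { Carrier = Fix
    ; _≈_ = _≈ᶠ_
    ; _≤_ = _≤ᶠ_
    ; _∙_ = _∙ᶠ_
    ; ε = εᶠ
    ; isMonoid = record
      { isSemigroup = record
        { isMagma = record { isEquivalence = isEquivalenceᶠ ; ∙-cong = λ {x} {y} {u} {v} → ∙ᶠ-cong {x} {y} {u} {v} }
        ; assoc = assocᶠ }
      ; identity = identityˡᶠ , identityʳᶠ }
    ; isPartialOrder = record
      { isPreorder = record
        { isEquivalence = isEquivalenceᶠ
        ; reflexive = reflexive
        ; trans = ≤-trans }
      ; antisym = antisym }
    ; ∙-mono = λ p q → monotone (∙-mono p q)
    }

NuclearImage : ∀ {c ℓ₁ ℓ₂} (M : Pomonoid c ℓ₁ ℓ₂) → Nucleus M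
             → Pomonoid (c ⊔ ℓ₁) ℓ₁ ℓ₂
NuclearImage M γ = NuclearImageConstruction.nuclearImage M γ

record _≅_ {c ℓ₁ ℓ₂ c' ℓ₁' ℓ₂'} (A : Pomonoid c ℓ₁ ℓ₂) (B : Pomonoid c' ℓ₁' ℓ₂')
       : Set (c ⊔ ℓ₁ ⊔ ℓ₂ ⊔ c' ⊔ ℓ₁' ⊔ ℓ₂') where
  private
    module A = Pomonoid A
    module B = Pomonoid B
  field
    f          : A.Carrier → B.Carrier
    cong       : ∀ {a b} → a A.≈ b → f a B.≈ f b
    injective  : ∀ {a b} → f a B.≈ f b → a A.≈ b
    surjective : ∀ y → ∃ λ x → f x B.≈ y
    homo       : ∀ a b → f (a A.∙ b) B.≈ f a B.∙ f b
    ε-homo     : f A.ε B.≈ B.ε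
    mono       : ∀ {a b} → a A.≤ b → f a B.≤ f b
    reflects   : ∀ {a b} → f a B.≤ f b → a A.≤ b

-- "N is isomorphic to a nuclear image of some pomonoid M satisfying P".
-- The witness M is allowed to live in the universe c ⊔ ℓ₁ ⊔ ℓ₂ (for carrier,
-- equality and order), which contains N itself.
IsoToNuclearImageOf : ∀ {c ℓ₁ ℓ₂ p}
                    → (Pomonoid (c ⊔ ℓ₁ ⊔ ℓ₂) (c ⊔ ℓ₁ ⊔ ℓ₂) (c ⊔ ℓ₁ ⊔ ℓ₂) → Set p)
                    → Pomonoid c ℓ₁ ℓ₂ → Set (suc (c ⊔ ℓ₁ ⊔ ℓ₂) ⊔ p)
IsoToNuclearImageOf P N =
  Σ _ λ M → P M × Σ (Nucleus M) λ γ → N ≅ NuclearImage M γ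

{-# OPTIONS --safe #-}
-- Represent N inside the free monoid on its elements, where a word u lies below
-- b₁ ⋯ bₙ when u can be cut into consecutive blocks p₁ ⋯ pₙ r with π pᵢ ≤ bᵢ and
-- π r ≤ 1 (π = product in N). Collapsing a word to the one-letter word π u is a
-- nucleus whose image is N. Cancellativity of this order is exactly integral
-- closure of N: in a·u ≤ a·v the block under the leading a is either empty
-- (then 1 ≤ a and the letter a of a·u may be dropped) or of the form a·p with
-- a·π p ≤ a, so π p ≤ 1 and p may be absorbed. In the commutative case the
-- blocks are taken up to permutation. Conversely, if γ(ax) ≤ a in a nuclear
-- image of a cancellative M, then ax ≤ a·1 in M, so x ≤ 1 ≤ γ 1.
module Submission where

open import Defs
open import Level using (Level; _⊔_; Lift; lift; lower)
open import Data.Product using (_×_; _,_; proj₁; proj₂; ∃; ∃₂)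
open import Data.Sum using (_⊎_; inj₁; inj₂)
open import Data.List using (List; []; _∷_; _++_; [_])
open import Data.List.Properties using (++-assoc; ++-identityʳ; ∷-injective)
open import Data.List.Membership.Propositional.Properties using (∈-++⁻; ∈-∃++)
open import Data.List.Relation.Unary.Any using (here)
open import Data.List.Relation.Binary.Permutation.Propositional as ↭
  using (_↭_; ↭-refl; ↭-sym; ↭-trans; ↭-reflexive; prep; swap)
open import Data.List.Relation.Binary.Permutation.Propositional.Properties
  using (++⁺ˡ; ++⁺ʳ; ++-comm; shift; shifts; drop-∷; ∈-resp-↭)
open import Relation.Binary.Core using (Rel)
open import Relation.Binary.Bundles using (Poset)
open import Relation.Binary.Structures using (IsEquivalence)
open import Relation.Binary.PropositionalEquality as ≡ using (_≡_; refl; cong; cong₂)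
import Relation.Binary.Reasoning.PartialOrder as PartialOrderReasoning

module _ {c ℓ₁ ℓ₂ c′ ℓ₁′ ℓ₂′} {N : Pomonoid c ℓ₁ ℓ₂} {I : Pomonoid c′ ℓ₁′ ℓ₂′}
         (iso : N ≅ I) where
  private
    module N = Pomonoid N
    module I = Pomonoid I
    module IE = IsEquivalence I.isEquivalence
  open _≅_ iso

  private
    mono-∙ : ∀ {a x b} → a N.∙ x N.≤ b → f a I.∙ f x I.≤ f b
    mono-∙ {a} {x} h = I.≤-trans (I.reflexive (IE.sym (homo a x))) (mono h)

    reflects-ε : ∀ {x} → f x I.≤ I.ε → x N.≤ N.ε
    reflects-ε h = reflects (I.≤-trans h (I.reflexive (IE.sym ε-homo)))

  ≅-integrallyClosed : IntegrallyClosed I → IntegrallyClosed N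
  ≅-integrallyClosed (icˡ , icʳ) =
      (λ a x h → reflects-ε (icˡ (f a) (f x) (mono-∙ h)))
    , (λ a x h → reflects-ε (icʳ (f a) (f x) (mono-∙ h)))

  ≅-integral : Integral I → Integral N
  ≅-integral int a = reflects-ε (int (f a))

  ≅-commutative : Commutative I → Commutative N
  ≅-commutative comm a b =
    injective (IE.trans (homo a b) (IE.trans (comm (f a) (f b)) (IE.sym (homo b a))))

module _ {c ℓ₁ ℓ₂} {M : Pomonoid c ℓ₁ ℓ₂} (ν : Nucleus M) where
  open Pomonoid M
  open Nucleus ν
  open NuclearImageConstruction M ν using (γ-cong)
  private module E = IsEquivalence isEquivalence

  nuclearImage-integrallyClosed : Cancellative M → IntegrallyClosed (NuclearImage M ν)
  nuclearImage-integrallyClosed (cancelʳ , cancelˡ) =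
      (λ { (a , _) (x , _) γax≤a → ≤-trans
             (cancelˡ x ε a (≤-trans (extensive _) (≤-trans γax≤a (reflexive (E.sym (identityʳ a))))))
             (extensive ε) })
    , (λ { (a , _) (x , _) γxa≤a → ≤-trans
             (cancelʳ x ε a (≤-trans (extensive _) (≤-trans γxa≤a (reflexive (E.sym (identityˡ a))))))
             (extensive ε) })

  nuclearImage-integral : Integral M → Integral (NuclearImage M ν)
  nuclearImage-integral int (a , _) = ≤-trans (int a) (extensive ε)

  nuclearImage-commutative : Commutative M → Commutative (NuclearImage M ν)
  nuclearImage-commutative comm (a , _) (b , _) = γ-cong (comm a b)

integral⇒integrallyClosed : ∀ {c ℓ₁ ℓ₂} (M : Pomonoid c ℓ₁ ℓ₂) →
                            Integral M → IntegrallyClosed M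
integral⇒integrallyClosed M int = (λ _ x _ → int x) , (λ _ x _ → int x)

module _ {a} {A : Set a} where

  ++-≡-∷ʳ : ∀ (p q u : List A) x → p ++ q ≡ u ++ [ x ] →
            (q ≡ [] × p ≡ u ++ [ x ]) ⊎ (∃ λ q′ → q ≡ q′ ++ [ x ] × p ++ q′ ≡ u)
  ++-≡-∷ʳ []          q       u       x e    = inj₂ (u , e , refl)
  ++-≡-∷ʳ (y ∷ [])    []      []      x refl = inj₁ (refl , refl)
  ++-≡-∷ʳ (y ∷ [])    (z ∷ q) []      x ()
  ++-≡-∷ʳ (y ∷ z ∷ p) q       []      x ()
  ++-≡-∷ʳ (y ∷ p)     q       (z ∷ u) x e with ∷-injective e
  ... | y≡z , e′ with ++-≡-∷ʳ p q u x e′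
  ...   | inj₁ (q≡[] , p≡) = inj₁ (q≡[] , cong₂ _∷_ y≡z p≡)
  ...   | inj₂ (q′ , q≡ , p≡) = inj₂ (q′ , q≡ , cong₂ _∷_ y≡z p≡)

  ∷↭++⁻ : ∀ {x : A} {u} p q → x ∷ u ↭ p ++ q →
          (∃ λ p′ → p ↭ x ∷ p′ × u ↭ p′ ++ q) ⊎ (∃ λ q′ → q ↭ x ∷ q′ × u ↭ p ++ q′)
  ∷↭++⁻ {x} p q e with ∈-++⁻ p (∈-resp-↭ e (here refl))
  ... | inj₁ x∈p with ∈-∃++ x∈p
  ...   | p₁ , p₂ , refl = inj₁ (p₁ ++ p₂ , shift x p₁ p₂ , drop-∷ (↭-trans e moved))
    where
    moved : (p₁ ++ x ∷ p₂) ++ q ↭ x ∷ (p₁ ++ p₂) ++ q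
    moved = ↭-trans (↭-reflexive (++-assoc p₁ (x ∷ p₂) q))
              (↭-trans (shift x p₁ (p₂ ++ q))
                (↭-reflexive (cong (x ∷_) (≡.sym (++-assoc p₁ p₂ q)))))
  ∷↭++⁻ {x} p q e | inj₂ x∈q with ∈-∃++ x∈q
  ...   | q₁ , q₂ , refl = inj₂ (q₁ ++ q₂ , shift x q₁ q₂ , drop-∷ (↭-trans e moved))
    where
    moved : p ++ q₁ ++ x ∷ q₂ ↭ x ∷ p ++ q₁ ++ q₂
    moved = ↭-trans (++⁺ˡ p (shift x q₁ q₂)) (shift x p (q₁ ++ q₂))

module Words {c ℓ₁ ℓ₂} (N : Pomonoid c ℓ₁ ℓ₂) where
  open Pomonoid N
  private module E = IsEquivalence isEquivalence

  poset : Poset c ℓ₁ ℓ₂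
  poset = record { isPartialOrder = isPartialOrder }

  open PartialOrderReasoning poset

  L : Level
  L = c ⊔ ℓ₁ ⊔ ℓ₂

  -- Lifted so that the word pomonoid lives in the single universe demanded by
  -- IsoToNuclearImageOf.
  Letter : Set L
  Letter = Lift (ℓ₁ ⊔ ℓ₂) Carrier

  Word : Set L
  Word = List Letter

  π : Word → Carrier
  π []      = ε
  π (x ∷ u) = lower x ∙ π u

  ⟦_⟧ : Carrier → Word
  ⟦ a ⟧ = [ lift a ]

  π-⟦⟧ : ∀ a → π ⟦ a ⟧ ≈ a
  π-⟦⟧ = identityʳ

  π-++ : ∀ u v → π (u ++ v) ≈ π u ∙ π v
  π-++ []      v = E.sym (identityˡ _)
  π-++ (x ∷ u) v = E.trans (∙-cong E.refl (π-++ u v)) (E.sym (assoc _ _ _))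

  π-≤ε-++ : ∀ u {v w} → π u ≤ ε → π v ≤ w → π (u ++ v) ≤ w
  π-≤ε-++ u {v} {w} u≤ε v≤w = begin
    π (u ++ v)  ≈⟨ π-++ u v ⟩
    π u ∙ π v   ≤⟨ ∙-mono u≤ε v≤w ⟩
    ε ∙ w       ≈⟨ identityˡ w ⟩
    w           ∎

  module Presentation
    (_≼_      : Rel Word L)
    (≼-refl   : ∀ u → u ≼ u)
    (≼-trans  : ∀ {u v w} → u ≼ v → v ≼ w → u ≼ w)
    (≼-++     : ∀ {u v u′ v′} → u ≼ v → u′ ≼ v′ → (u ++ u′) ≼ (v ++ v′))
    (π-mono   : ∀ {u v} → u ≼ v → π u ≤ π v)
    (≼-⟦⟧     : ∀ {u a} → π u ≤ a → u ≼ ⟦ a ⟧)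
    where

    _≋_ : Rel Word L
    u ≋ v = u ≼ v × v ≼ u

    ≋-isEquivalence : IsEquivalence _≋_
    ≋-isEquivalence = record
      { refl  = λ {u} → ≼-refl u , ≼-refl u
      ; sym   = λ (p , q) → q , p
      ; trans = λ (p , q) (p′ , q′) → ≼-trans p p′ , ≼-trans q′ q
      }

    ≡⇒≋ : ∀ {u v} → u ≡ v → u ≋ v
    ≡⇒≋ refl = IsEquivalence.refl ≋-isEquivalence

    wordPomonoid : Pomonoid L L L
    wordPomonoid = record
      { Carrier  = Word
      ; _≈_      = _≋_
      ; _≤_      = _≼_
      ; _∙_      = _++_
      ; ε        = []
      ; isMonoid = record
        { isSemigroup = record
          { isMagma = record
            { isEquivalence = ≋-isEquivalence
            ; ∙-cong        = λ (p , q) (p′ , q′) → ≼-++ p p′ , ≼-++ q q′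
            }
          ; assoc = λ u v w → ≡⇒≋ (++-assoc u v w)
          }
        ; identity = (λ u → ≡⇒≋ refl) , (λ u → ≡⇒≋ (++-identityʳ u))
        }
      ; isPartialOrder = record
        { isPreorder = record
          { isEquivalence = ≋-isEquivalence
          ; reflexive     = proj₁
          ; trans         = ≼-trans
          }
        ; antisym = _,_
        }
      ; ∙-mono = ≼-++
      }

    ⟦⟧-mono : ∀ {a b} → a ≤ b → ⟦ a ⟧ ≼ ⟦ b ⟧
    ⟦⟧-mono a≤b = ≼-⟦⟧ (≤-trans (reflexive (π-⟦⟧ _)) a≤b)

    ⟦⟧-cong : ∀ {a b} → a ≈ b → ⟦ a ⟧ ≋ ⟦ b ⟧
    ⟦⟧-cong a≈b = ⟦⟧-mono (reflexive a≈b) , ⟦⟧-mono (reflexive (E.sym a≈b))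

    ⟦⟧-reflects : ∀ {a b} → ⟦ a ⟧ ≼ ⟦ b ⟧ → a ≤ b
    ⟦⟧-reflects {a} {b} p = begin
      a        ≈⟨ π-⟦⟧ a ⟨
      π ⟦ a ⟧  ≤⟨ π-mono p ⟩
      π ⟦ b ⟧  ≈⟨ π-⟦⟧ b ⟩
      b        ∎

    collapse : Nucleus wordPomonoid
    collapse = record
      { γ                 = λ u → ⟦ π u ⟧
      ; monotone          = λ u≼v → ⟦⟧-mono (π-mono u≼v)
      ; extensive         = λ u → ≼-⟦⟧ ≤-refl
      ; idempotent        = λ u → ⟦⟧-cong (π-⟦⟧ (π u))
      ; submultiplicative = λ u v → ≼-⟦⟧ (reflexive (E.trans (π-++ ⟦ π u ⟧ ⟦ π v ⟧)
          (E.trans (∙-cong (π-⟦⟧ (π u)) (π-⟦⟧ (π v))) (E.sym (π-++ u v)))))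
      }

    ≅-collapse : N ≅ NuclearImage wordPomonoid collapse
    ≅-collapse = record
      { f          = λ a → ⟦ a ⟧ , ⟦⟧-cong (π-⟦⟧ a)
      ; cong       = ⟦⟧-cong
      ; injective  = λ (p , q) → antisym (⟦⟧-reflects p) (⟦⟧-reflects q)
      ; surjective = λ (u , γu≋u) → π u , γu≋u
      ; homo       = λ a b → ⟦⟧-cong (∙-cong E.refl (E.sym (π-⟦⟧ b)))
      ; ε-homo     = ⟦⟧-cong E.refl
      ; mono       = ⟦⟧-mono
      ; reflects   = ⟦⟧-reflects
      }

    isoToNuclearImage : ∀ {p} {P : Pomonoid L L L → Set p} →
                        P wordPomonoid → IsoToNuclearImageOf P N
    isoToNuclearImage pM = wordPomonoid , pM , collapse , ≅-collapse

  x≤a∙x : ∀ {a x} → ε ≤ a → x ≤ a ∙ x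
  x≤a∙x {a} {x} ε≤a = begin
    x      ≈⟨ identityˡ x ⟨
    ε ∙ x  ≤⟨ ∙-mono ε≤a ≤-refl ⟩
    a ∙ x  ∎

  x≤x∙a : ∀ {a x} → ε ≤ a → x ≤ x ∙ a
  x≤x∙a {a} {x} ε≤a = begin
    x      ≈⟨ identityʳ x ⟨
    x ∙ ε  ≤⟨ ∙-mono ≤-refl ε≤a ⟩
    x ∙ a  ∎

  infix 4 _≼_

  data _≼_ : Word → Word → Set L where
    done  : ∀ {u} → π u ≤ ε → u ≼ []
    block : ∀ {u b v} p q → p ++ q ≡ u → π p ≤ lower b → q ≼ v → u ≼ b ∷ v

  ≼-refl : ∀ u → u ≼ u
  ≼-refl []      = done ≤-refl
  ≼-refl (x ∷ u) = block [ x ] u refl (reflexive (π-⟦⟧ _)) (≼-refl u)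

  π-mono : ∀ {u v} → u ≼ v → π u ≤ π v
  π-mono (done u≤ε)                = u≤ε
  π-mono (block p q refl p≤b q≼v) = ≤-trans (reflexive (π-++ p q)) (∙-mono p≤b (π-mono q≼v))

  ≼-≤ε-++ : ∀ j {u v} → π j ≤ ε → u ≼ v → j ++ u ≼ v
  ≼-≤ε-++ j j≤ε (done u≤ε)                = done (π-≤ε-++ j j≤ε u≤ε)
  ≼-≤ε-++ j j≤ε (block p q refl p≤b q≼v) = block (j ++ p) q (++-assoc j p q) (π-≤ε-++ j j≤ε p≤b) q≼v

  ≼-++ : ∀ {u v u′ v′} → u ≼ v → u′ ≼ v′ → u ++ u′ ≼ v ++ v′
  ≼-++ {u} (done u≤ε) u′≼v′ = ≼-≤ε-++ u u≤ε u′≼v′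
  ≼-++ {u′ = u′} (block p q refl p≤b q≼v) u′≼v′ =
    block p (q ++ u′) (≡.sym (++-assoc p q u′)) p≤b (≼-++ q≼v u′≼v′)

  ≼-split : ∀ v {v′ u} → u ≼ v ++ v′ → ∃₂ λ u₁ u₂ → u₁ ++ u₂ ≡ u × u₁ ≼ v × u₂ ≼ v′
  ≼-split []      {u = u} u≼v′ = [] , u , refl , done ≤-refl , u≼v′
  ≼-split (b ∷ v) (block p q refl p≤b q≼vv′) with ≼-split v q≼vv′
  ... | q₁ , q₂ , refl , q₁≼v , q₂≼v′ =
    p ++ q₁ , q₂ , ++-assoc p q₁ q₂ , block p q₁ refl p≤b q₁≼v , q₂≼v′

  ≼-trans : ∀ {u v w} → u ≼ v → v ≼ w → u ≼ w
  ≼-trans u≼v (done v≤ε) = done (≤-trans (π-mono u≼v) v≤ε)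
  ≼-trans u≼v (block p q refl p≤b q≼w) with ≼-split p u≼v
  ... | u₁ , u₂ , e , u₁≼p , u₂≼q =
    block u₁ u₂ e (≤-trans (π-mono u₁≼p) p≤b) (≼-trans u₂≼q q≼w)

  ≼-⟦⟧ : ∀ {u a} → π u ≤ a → u ≼ ⟦ a ⟧
  ≼-⟦⟧ {u} u≤a = block u [] (++-identityʳ u) u≤a (done ≤-refl)

  module Block = Presentation _≼_ ≼-refl ≼-trans ≼-++ π-mono ≼-⟦⟧

  ≼-integral : Integral N → Integral Block.wordPomonoid
  ≼-integral int u = done (int (π u))

  ≼-drop-≥ε : ∀ {a u v} → ε ≤ lower a → a ∷ u ≼ v → u ≼ v
  ≼-drop-≥ε ε≤a (done au≤ε) = done (≤-trans (x≤a∙x ε≤a) au≤ε)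
  ≼-drop-≥ε ε≤a (block []      q refl p≤b q≼v) = block [] _ refl p≤b (≼-drop-≥ε ε≤a q≼v)
  ≼-drop-≥ε ε≤a (block (x ∷ p) q refl xp≤b q≼v) = block p q refl (≤-trans (x≤a∙x ε≤a) xp≤b) q≼v

  []≼-++-⟦⟧ : ∀ v {a} → [] ≼ v ++ ⟦ a ⟧ → ε ≤ a × [] ≼ v
  []≼-++-⟦⟧ []      (block [] [] refl ε≤a _) = ε≤a , done ≤-refl
  []≼-++-⟦⟧ (b ∷ v) (block [] [] refl ε≤b []≼va) with []≼-++-⟦⟧ v []≼va
  ... | ε≤a , []≼v = ε≤a , block [] [] refl ε≤b []≼v

  module _ (ic : IntegrallyClosed N) where

    ∷-cancelˡ : ∀ {a u v} → a ∷ u ≼ a ∷ v → u ≼ v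
    ∷-cancelˡ (block []      q refl ε≤a u≼v) = ≼-drop-≥ε ε≤a u≼v
    ∷-cancelˡ {a} (block (x ∷ p) q refl ap≤a q≼v) = ≼-≤ε-++ p (proj₁ ic (lower a) (π p) ap≤a) q≼v

    ++-cancelˡ : ∀ w {u v} → w ++ u ≼ w ++ v → u ≼ v
    ++-cancelˡ []      wu≼wv = wu≼wv
    ++-cancelˡ (a ∷ w) wu≼wv = ++-cancelˡ w (∷-cancelˡ wu≼wv)

    ∷ʳ-cancelʳ : ∀ v {u a} → u ++ ⟦ a ⟧ ≼ v ++ ⟦ a ⟧ → u ≼ v
    ∷ʳ-cancelʳ []      {u} {a} ua≼a =
      done (proj₂ ic (π ⟦ a ⟧) (π u) (≤-trans (reflexive (E.sym (π-++ u ⟦ a ⟧))) (π-mono ua≼a)))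
    ∷ʳ-cancelʳ (b ∷ v) {u} {a} (block p q e p≤b q≼va) with ++-≡-∷ʳ p q u (lift a) e
    ... | inj₂ (q′ , refl , pq′≡u) = block p q′ pq′≡u p≤b (∷ʳ-cancelʳ v q≼va)
    ... | inj₁ (refl , refl) with []≼-++-⟦⟧ v q≼va
    ...   | ε≤a , []≼v = block u [] (++-identityʳ u) u≤b []≼v
      where
      u≤b : π u ≤ lower b
      u≤b = begin
        π u              ≤⟨ x≤x∙a ε≤a ⟩
        π u ∙ a          ≈⟨ ∙-cong E.refl (π-⟦⟧ a) ⟨
        π u ∙ π ⟦ a ⟧    ≈⟨ π-++ u ⟦ a ⟧ ⟨
        π (u ++ ⟦ a ⟧)   ≤⟨ p≤b ⟩
        lower b          ∎

    ++-cancelʳ : ∀ w {u v} → u ++ w ≼ v ++ w → u ≼ v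
    ++-cancelʳ []      {u} {v} uw≼vw =
      ≡.subst₂ _≼_ (++-identityʳ u) (++-identityʳ v) uw≼vw
    ++-cancelʳ (a ∷ w) {u} {v} uw≼vw = ∷ʳ-cancelʳ v (++-cancelʳ w
      (≡.subst₂ _≼_ (≡.sym (++-assoc u ⟦ lower a ⟧ w)) (≡.sym (++-assoc v ⟦ lower a ⟧ w)) uw≼vw))

    ≼-cancellative : Cancellative Block.wordPomonoid
    ≼-cancellative = (λ u v w → ++-cancelʳ w) , (λ u v w → ++-cancelˡ w)

  module CommutativeBlocks (comm : Commutative N) where

    infix 4 _≼ᶜ_

    data _≼ᶜ_ : Word → Word → Set L where
      done  : ∀ {u} → π u ≤ ε → u ≼ᶜ []
      block : ∀ {u b v} p q → u ↭ p ++ q → π p ≤ lower b → q ≼ᶜ v → u ≼ᶜ b ∷ v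

    π-↭ : ∀ {u v} → u ↭ v → π u ≈ π v
    π-↭ ↭.refl          = E.refl
    π-↭ (prep x u↭v)    = ∙-cong E.refl (π-↭ u↭v)
    π-↭ (swap x y u↭v)  =
      E.trans (E.sym (assoc _ _ _)) (E.trans (∙-cong (comm _ _) (π-↭ u↭v)) (assoc _ _ _))
    π-↭ (↭.trans u↭v v↭w) = E.trans (π-↭ u↭v) (π-↭ v↭w)

    ≼ᶜ-respˡ-↭ : ∀ {u u′ v} → u ↭ u′ → u ≼ᶜ v → u′ ≼ᶜ v
    ≼ᶜ-respˡ-↭ u↭u′ (done u≤ε) = done (≤-trans (reflexive (E.sym (π-↭ u↭u′))) u≤ε)
    ≼ᶜ-respˡ-↭ u↭u′ (block p q u↭pq p≤b q≼v) = block p q (↭-trans (↭-sym u↭u′) u↭pq) p≤b q≼v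

    ≼ᶜ-refl : ∀ u → u ≼ᶜ u
    ≼ᶜ-refl []      = done ≤-refl
    ≼ᶜ-refl (x ∷ u) = block [ x ] u ↭-refl (reflexive (π-⟦⟧ _)) (≼ᶜ-refl u)

    π-monoᶜ : ∀ {u v} → u ≼ᶜ v → π u ≤ π v
    π-monoᶜ (done u≤ε) = u≤ε
    π-monoᶜ (block p q u↭pq p≤b q≼v) =
      ≤-trans (reflexive (E.trans (π-↭ u↭pq) (π-++ p q))) (∙-mono p≤b (π-monoᶜ q≼v))

    ≼ᶜ-≤ε-++ : ∀ j {u v} → π j ≤ ε → u ≼ᶜ v → j ++ u ≼ᶜ v
    ≼ᶜ-≤ε-++ j j≤ε (done u≤ε) = done (π-≤ε-++ j j≤ε u≤ε)
    ≼ᶜ-≤ε-++ j j≤ε (block p q u↭pq p≤b q≼v) =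
      block (j ++ p) q (↭-trans (++⁺ˡ j u↭pq) (↭-reflexive (≡.sym (++-assoc j p q))))
        (π-≤ε-++ j j≤ε p≤b) q≼v

    ≼ᶜ-++ : ∀ {u v u′ v′} → u ≼ᶜ v → u′ ≼ᶜ v′ → u ++ u′ ≼ᶜ v ++ v′
    ≼ᶜ-++ {u} (done u≤ε) u′≼v′ = ≼ᶜ-≤ε-++ u u≤ε u′≼v′
    ≼ᶜ-++ {u′ = u′} (block p q u↭pq p≤b q≼v) u′≼v′ =
      block p (q ++ u′) (↭-trans (++⁺ʳ u′ u↭pq) (↭-reflexive (++-assoc p q u′))) p≤b
        (≼ᶜ-++ q≼v u′≼v′)

    ≼ᶜ-split : ∀ v {v′ u} → u ≼ᶜ v ++ v′ → ∃₂ λ u₁ u₂ → u ↭ u₁ ++ u₂ × u₁ ≼ᶜ v × u₂ ≼ᶜ v′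
    ≼ᶜ-split []      {u = u} u≼v′ = [] , u , ↭-refl , done ≤-refl , u≼v′
    ≼ᶜ-split (b ∷ v) (block p q u↭pq p≤b q≼vv′) with ≼ᶜ-split v q≼vv′
    ... | q₁ , q₂ , q↭q₁q₂ , q₁≼v , q₂≼v′ =
      p ++ q₁ , q₂
      , ↭-trans u↭pq (↭-trans (++⁺ˡ p q↭q₁q₂) (↭-reflexive (≡.sym (++-assoc p q₁ q₂))))
      , block p q₁ ↭-refl p≤b q₁≼v , q₂≼v′

    ≼ᶜ-respʳ-↭ : ∀ {u v v′} → u ≼ᶜ v → v ↭ v′ → u ≼ᶜ v′
    ≼ᶜ-respʳ-↭ u≼v ↭.refl = u≼v
    ≼ᶜ-respʳ-↭ (block p q u↭pq p≤b q≼v) (prep x v↭v′) = block p q u↭pq p≤b (≼ᶜ-respʳ-↭ q≼v v↭v′)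
    ≼ᶜ-respʳ-↭ (block p q u↭pq p≤a (block p′ q′ q↭p′q′ p′≤b q′≼v)) (swap a b v↭v′) =
      block p′ (p ++ q′) (↭-trans u↭pq (↭-trans (++⁺ˡ p q↭p′q′) (shifts p p′))) p′≤b
        (block p q′ ↭-refl p≤a (≼ᶜ-respʳ-↭ q′≼v v↭v′))
    ≼ᶜ-respʳ-↭ u≼v (↭.trans v↭w w↭v′) = ≼ᶜ-respʳ-↭ (≼ᶜ-respʳ-↭ u≼v v↭w) w↭v′

    ≼ᶜ-trans : ∀ {u v w} → u ≼ᶜ v → v ≼ᶜ w → u ≼ᶜ w
    ≼ᶜ-trans u≼v (done v≤ε) = done (≤-trans (π-monoᶜ u≼v) v≤ε)
    ≼ᶜ-trans u≼v (block p q v↭pq p≤b q≼w) with ≼ᶜ-split p (≼ᶜ-respʳ-↭ u≼v v↭pq)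
    ... | u₁ , u₂ , u↭u₁u₂ , u₁≼p , u₂≼q =
      block u₁ u₂ u↭u₁u₂ (≤-trans (π-monoᶜ u₁≼p) p≤b) (≼ᶜ-trans u₂≼q q≼w)

    ≼ᶜ-⟦⟧ : ∀ {u a} → π u ≤ a → u ≼ᶜ ⟦ a ⟧
    ≼ᶜ-⟦⟧ {u} u≤a = block u [] (↭-reflexive (≡.sym (++-identityʳ u))) u≤a (done ≤-refl)

    module Blockᶜ = Presentation _≼ᶜ_ ≼ᶜ-refl ≼ᶜ-trans ≼ᶜ-++ π-monoᶜ ≼ᶜ-⟦⟧

    ≼ᶜ-integral : Integral N → Integral Blockᶜ.wordPomonoid
    ≼ᶜ-integral int u = done (int (π u))

    ≼ᶜ-commutative : Commutative Blockᶜ.wordPomonoid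
    ≼ᶜ-commutative u v = ≼ᶜ-respˡ-↭ (++-comm v u) (≼ᶜ-refl (v ++ u))
                       , ≼ᶜ-respˡ-↭ (++-comm u v) (≼ᶜ-refl (u ++ v))

    ≼ᶜ-refine : ∀ v {p a r} → π p ≤ lower a → a ∷ r ≼ᶜ v → p ++ r ≼ᶜ v
    ≼ᶜ-refine []      {p} {a} {r} p≤a (done ar≤ε) = done (begin
      π (p ++ r)       ≈⟨ π-++ p r ⟩
      π p ∙ π r        ≤⟨ ∙-mono p≤a ≤-refl ⟩
      π (a ∷ r)        ≤⟨ ar≤ε ⟩
      ε                ∎)
    ≼ᶜ-refine (b ∷ v) {p} p≤a (block p₁ q₁ ar↭p₁q₁ p₁≤b q₁≼v) with ∷↭++⁻ p₁ q₁ ar↭p₁q₁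
    ... | inj₁ (p₁′ , p₁↭ap₁′ , r↭p₁′q₁) =
      block (p ++ p₁′) q₁ (↭-trans (++⁺ˡ p r↭p₁′q₁) (↭-reflexive (≡.sym (++-assoc p p₁′ q₁))))
        (begin
          π (p ++ p₁′)   ≈⟨ π-++ p p₁′ ⟩
          π p ∙ π p₁′    ≤⟨ ∙-mono p≤a ≤-refl ⟩
          π (_ ∷ p₁′)    ≈⟨ π-↭ p₁↭ap₁′ ⟨
          π p₁           ≤⟨ p₁≤b ⟩
          lower b        ∎)
        q₁≼v
    ... | inj₂ (q₁′ , q₁↭aq₁′ , r↭p₁q₁′) =
      block p₁ (p ++ q₁′) (↭-trans (++⁺ˡ p r↭p₁q₁′) (shifts p p₁)) p₁≤b
        (≼ᶜ-refine v p≤a (≼ᶜ-respˡ-↭ q₁↭aq₁′ q₁≼v))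

    module _ (ic : IntegrallyClosed N) where

      ∷-cancelᶜ : ∀ {a u v} → a ∷ u ≼ᶜ a ∷ v → u ≼ᶜ v
      ∷-cancelᶜ {a} (block p q au↭pq p≤a q≼v) with ∷↭++⁻ p q au↭pq
      ... | inj₁ (p′ , p↭ap′ , u↭p′q) =
        ≼ᶜ-respˡ-↭ (↭-sym u↭p′q)
          (≼ᶜ-≤ε-++ p′ (proj₁ ic (lower a) (π p′) (≤-trans (reflexive (π-↭ (↭-sym p↭ap′))) p≤a)) q≼v)
      ... | inj₂ (q′ , q↭aq′ , u↭pq′) =
        ≼ᶜ-respˡ-↭ (↭-sym u↭pq′) (≼ᶜ-refine _ p≤a (≼ᶜ-respˡ-↭ q↭aq′ q≼v))

      ++-cancelᶜ : ∀ w {u v} → w ++ u ≼ᶜ w ++ v → u ≼ᶜ v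
      ++-cancelᶜ []      wu≼wv = wu≼wv
      ++-cancelᶜ (a ∷ w) wu≼wv = ++-cancelᶜ w (∷-cancelᶜ wu≼wv)

      ≼ᶜ-cancellative : Cancellative Blockᶜ.wordPomonoid
      ≼ᶜ-cancellative =
          (λ u v w uw≼vw → ++-cancelᶜ w (≼ᶜ-respʳ-↭ (≼ᶜ-respˡ-↭ (++-comm u w) uw≼vw) (++-comm v w)))
        , (λ u v w → ++-cancelᶜ w)

mainTheorem8 : ∀ {c ℓ₁ ℓ₂} (N : Pomonoid c ℓ₁ ℓ₂) →
    -- integrally closed  ⇔  ≅ nuclear image of a cancellative pomonoid
    ((IntegrallyClosed N → IsoToNuclearImageOf (λ M → Cancellative M) N)
      × (IsoToNuclearImageOf (λ M → Cancellative M) N → IntegrallyClosed N))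
    -- integral  ⇔  ≅ nuclear image of an integral cancellative pomonoid
    × ((Integral N → IsoToNuclearImageOf (λ M → Integral M × Cancellative M) N)
      × (IsoToNuclearImageOf (λ M → Integral M × Cancellative M) N → Integral N))
    -- commutative integrally closed  ⇔  ≅ nuclear image of a commutative cancellative pomonoid
    × ((Commutative N × IntegrallyClosed N → IsoToNuclearImageOf (λ M → Commutative M × Cancellative M) N)
      × (IsoToNuclearImageOf (λ M → Commutative M × Cancellative M) N → Commutative N × IntegrallyClosed N))
    -- commutative integral  ⇔  ≅ nuclear image of a commutative integral cancellative pomonoid
    × ((Commutative N × Integral N → IsoToNuclearImageOf (λ M → Commutative M × Integral M × Cancellative M) N)
      × (IsoToNuclearImageOf (λ M → Commutative M × Integral M × Cancellative M) N → Commutative N × Integral N))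
mainTheorem8 N =
    ( (λ ic → Block.isoToNuclearImage (≼-cancellative ic))
    , (λ (M , canc , ν , iso) → ≅-integrallyClosed iso (nuclearImage-integrallyClosed ν canc)) )
  , ( (λ int → Block.isoToNuclearImage (≼-integral int , ≼-cancellative (integral⇒integrallyClosed N int)))
    , (λ (M , (int , _) , ν , iso) → ≅-integral iso (nuclearImage-integral ν int)) )
  , ( (λ (comm , ic) → C.Blockᶜ.isoToNuclearImage comm
                         (C.≼ᶜ-commutative comm , C.≼ᶜ-cancellative comm ic))
    , (λ (M , (comm , canc) , ν , iso) → ≅-commutative iso (nuclearImage-commutative ν comm)
                                       , ≅-integrallyClosed iso (nuclearImage-integrallyClosed ν canc)) )
  , ( (λ (comm , int) → C.Blockᶜ.isoToNuclearImage comm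
                          (C.≼ᶜ-commutative comm , C.≼ᶜ-integral comm int
                          , C.≼ᶜ-cancellative comm (integral⇒integrallyClosed N int)))
    , (λ (M , (comm , int , _) , ν , iso) → ≅-commutative iso (nuclearImage-commutative ν comm)
                                          , ≅-integral iso (nuclearImage-integral ν int)) )
  where
  open Words N
  module C = CommutativeBlocks
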